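{- For every integer $d \geq 1$ there exist a $d$-regular bipartite graph $G$ and a partial proper $d$-edge coloring $\varphi$ of $G$ with exactly $d$ colored edges such that $\varphi$ is not avoidable.
   Context: A partial proper $d$-edge coloring of a graph $G$ is an assignment of colors from $\{1,\dots,d\}$ to the edges of some subset $E'\subseteq E(G)$ such that any two adjacent edges of $E'$ receive different colors. A partial coloring $\varphi$ is avoidable if there is a proper $d$-edge coloring $f$ of $G$ (using colors $1,\dots,d$) with $f(e)\neq\varphi(e)$ for every edge $e$ colored under $\varphi$. -}

module Defs where

open import Data.Nat using (ℕ)
open import Data.Fin using (Fin)
open import Data.Fin.Properties using (_≟_)
open import Data.Bool using (Bool; T)
open import Relation.Nullary.Decidable using (T?)
open import Data.Maybe using (Maybe; just; nothing; is-just)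
open import Data.List using (List; length; filter)
open import Data.List.Base using (allFin)
open import Data.Product using (_×_; _,_; proj₁; proj₂; Σ)
open import Data.Sum using (_⊎_)
open import Relation.Nullary using (¬_; Dec)
open import Relation.Unary using (Decidable)
open import Relation.Binary.PropositionalEquality using (_≡_; _≢_)
open import Relation.Nullary.Decidable using (_⊎-dec_)

record Graph : Set where
  field
    n   : ℕ
    m   : ℕ
    ends : Fin m → Fin n × Fin n

  src : Fin m → Fin n
  src e = proj₁ (ends e)

  tgt : Fin m → Fin n
  tgt e = proj₂ (ends e)

  Incident : Fin n → Fin m → Set
  Incident v e = (src e ≡ v) ⊎ (tgt e ≡ v)

  incident? : (v : Fin n) → Decidable (Incident v)
  incident? v e = (src e ≟ v) ⊎-dec (tgt e ≟ v)

  degree : Fin n → ℕ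
  degree v = length (filter (incident? v) (allFin m))

  Adjacent : Fin m → Fin m → Set
  Adjacent e e' = e ≢ e' × Σ (Fin n) (λ v → Incident v e × Incident v e')

open Graph public

Simple : Graph → Set
Simple G = (∀ e → src G e ≢ tgt G e)
         × (∀ e e' → e ≢ e' →
              ¬ ((src G e ≡ src G e' × tgt G e ≡ tgt G e')
                 ⊎ (src G e ≡ tgt G e' × tgt G e ≡ src G e')))

Bipartite : Graph → Set
Bipartite G = Σ (Fin (n G) → Bool) λ side → ∀ e → side (src G e) ≢ side (tgt G e)

Regular : ℕ → Graph → Set
Regular d G = ∀ v → degree G v ≡ d

-- proper d-edge coloring of all edges; colors Fin d stand for {1,…,d}
ProperEdgeColoring : (d : ℕ) (G : Graph) → (Fin (m G) → Fin d) → Set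
ProperEdgeColoring d G f = ∀ e e' → Adjacent G e e' → f e ≢ f e'

-- partial d-edge coloring: nothing = uncolored edge
PartialColoring : ℕ → Graph → Set
PartialColoring d G = Fin (m G) → Maybe (Fin d)

ProperPartial : (d : ℕ) (G : Graph) → PartialColoring d G → Set
ProperPartial d G φ = ∀ e e' (c c' : Fin d) → Adjacent G e e' →
  φ e ≡ just c → φ e' ≡ just c' → c ≢ c'

numColored : {d : ℕ} {G : Graph} → PartialColoring d G → ℕ
numColored {G = G} φ = length (filter (λ e → T? (is-just (φ e))) (allFin (m G)))

Avoidable : (d : ℕ) (G : Graph) → PartialColoring d G → Set
Avoidable d G φ = Σ (Fin (m G) → Fin d) λ f →
  ProperEdgeColoring d G f × (∀ e → φ e ≢ just (f e))

-- Take d copies of K_{d,d}; copy i has left vertices left i j and right vertices right i k.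
-- Remove from each copy the edge between left i 0 and right i 0, and instead join left i 0
-- to right (i + 1) 0, cyclically; call this new edge link i and precolour it with colour i. In a proper d-edge colouring every colour
-- occurs exactly once at each vertex, so counting a colour c over the rows and over the
-- columns of copy i shows that c is the colour of link i iff it is the colour of link (i - 1).
-- Hence all links share one colour c, so the colouring agrees with the precolouring on link c.
module Submission where

open import Defs hiding (n; m)
open import Data.Nat using (ℕ; zero; suc; _+_; _*_; _≥_)
open import Data.Nat.Properties using (+-0-commutativeMonoid; +-cancelʳ-≡; n≮n)
open import Data.Fin using (Fin; zero; suc; fromℕ; inject₁; punchIn; punchOut; combine; remQuot;
  _↑ˡ_; _↑ʳ_; splitAt)
open import Data.Fin.Properties using (_≟_; any?; punchInᵢ≢i; punchOut-injective; injective⇒≤;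
  fromℕ≢inject₁; inject₁-injective; combine-injective; combine-surjective; remQuot-combine;
  ↑ˡ-injective; ↑ʳ-injective; splitAt-↑ˡ; splitAt-↑ʳ; join-splitAt)
open import Data.Fin.Induction using (<-weakInduction)
open import Data.Bool using (Bool; true; false; T; T?)
open import Data.Maybe using (Maybe; just; nothing; is-just)
open import Data.List using (length; filter; tabulate; allFin)
open import Data.Product using (Σ; _×_; _,_; proj₁; proj₂; ∃; ∃₂; map₂)
open import Data.Sum using (_⊎_; inj₁; inj₂; [_,_]′)
open import Data.Unit using (tt)
open import Function using (_∘_; const)
open import Function.Definitions using (Injective; StrictlySurjective)
open import Relation.Nullary using (¬_; Dec; yes; no; contradiction)
open import Relation.Unary using (Pred; Decidable)
open import Relation.Binary.PropositionalEquality
open import Algebra.Properties.CommutativeMonoid.Sum +-0-commutativeMonoid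
  using (sum-syntax; sum-cong-≗; sum-replicate-zero; sum-remove; ∑-comm)

private variable
  A : Set
  k m n : ℕ

𝟙 : {P : Set} → Dec P → ℕ
𝟙 (yes _) = 1
𝟙 (no _)  = 0

𝟙-yes : {P : Set} (P? : Dec P) → P → 𝟙 P? ≡ 1
𝟙-yes (yes _) _ = refl
𝟙-yes (no ¬p) p = contradiction p ¬p

𝟙-no : {P : Set} (P? : Dec P) → ¬ P → 𝟙 P? ≡ 0
𝟙-no (yes p) ¬p = contradiction p ¬p
𝟙-no (no _)  _  = refl

𝟙≡1⇒ : {P : Set} (P? : Dec P) → 𝟙 P? ≡ 1 → P
𝟙≡1⇒ (yes p) _ = p

∑-ones : ∀ n → ∑[ _ < n ] 1 ≡ n
∑-ones zero    = refl
∑-ones (suc n) = cong suc (∑-ones n)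

∑-𝟙-none : {P : Pred (Fin n) _} (P? : Decidable P) → (∀ t → ¬ P t) → ∑[ t < n ] 𝟙 (P? t) ≡ 0
∑-𝟙-none {n} P? none = trans (sum-cong-≗ (λ t → 𝟙-no (P? t) (none t))) (sum-replicate-zero n)

∑-𝟙-unique : {P : Pred (Fin n) _} (P? : Decidable P) (t₀ : Fin n) → P t₀ → (∀ t → P t → t ≡ t₀) →
  ∑[ t < n ] 𝟙 (P? t) ≡ 1
∑-𝟙-unique {suc n} P? t₀ p unique = begin
  ∑[ t < suc n ] 𝟙 (P? t)                       ≡⟨ sum-remove {i = t₀} (λ t → 𝟙 (P? t)) ⟩
  𝟙 (P? t₀) + ∑[ t < n ] 𝟙 (P? (punchIn t₀ t))  ≡⟨ cong₂ _+_ (𝟙-yes (P? t₀) p) rest≡0 ⟩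
  1                                              ∎
  where
  open ≡-Reasoning
  rest≡0 : ∑[ t < n ] 𝟙 (P? (punchIn t₀ t)) ≡ 0
  rest≡0 = ∑-𝟙-none (P? ∘ punchIn t₀) (λ t → punchInᵢ≢i t₀ t ∘ unique (punchIn t₀ t))

length-filter-tabulate : {P : Pred A _} (P? : Decidable P) (g : Fin n → A) →
  length (filter P? (tabulate g)) ≡ ∑[ i < n ] 𝟙 (P? (g i))
length-filter-tabulate {n = zero}  P? g = refl
length-filter-tabulate {n = suc n} P? g with P? (g zero)
... | yes _ = cong suc (length-filter-tabulate P? (g ∘ suc))
... | no _  = length-filter-tabulate P? (g ∘ suc)

length-filter-allFin : {P : Pred (Fin m) _} (P? : Decidable P) (g : Fin k → Fin m) →
  Injective _≡_ _≡_ g → (∀ t → P (g t)) → (∀ e → P e → ∃ λ t → g t ≡ e) →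
  length (filter P? (allFin m)) ≡ k
length-filter-allFin {m = m} {k = k} {P = P} P? g g-injective g-sound g-complete = begin
  length (filter P? (allFin m))       ≡⟨ length-filter-tabulate P? (λ e → e) ⟩
  ∑[ e < m ] 𝟙 (P? e)                 ≡⟨ sum-cong-≗ 𝟙≡∑-fibre ⟩
  ∑[ e < m ] ∑[ t < k ] 𝟙 (g t ≟ e)   ≡⟨ ∑-comm (λ e t → 𝟙 (g t ≟ e)) ⟩
  ∑[ t < k ] ∑[ e < m ] 𝟙 (g t ≟ e)   ≡⟨ sum-cong-≗ (λ t → ∑-𝟙-unique (g t ≟_) (g t) refl (λ _ → sym)) ⟩
  ∑[ t < k ] 1                        ≡⟨ ∑-ones k ⟩
  k                                   ∎
  where
  open ≡-Reasoning
  𝟙≡∑-fibre : ∀ e → 𝟙 (P? e) ≡ ∑[ t < k ] 𝟙 (g t ≟ e)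
  𝟙≡∑-fibre e with P? e
  ... | yes p = let t₀ , gt₀≡e = g-complete e p in
    sym (∑-𝟙-unique (λ t → g t ≟ e) t₀ gt₀≡e (λ t gt≡e → g-injective (trans gt≡e (sym gt₀≡e))))
  ... | no ¬p = sym (∑-𝟙-none (λ t → g t ≟ e) (λ t gt≡e → ¬p (subst P gt≡e (g-sound t))))

injective⇒strictlySurjective : (h : Fin n → Fin n) → Injective _≡_ _≡_ h → StrictlySurjective _≡_ h
injective⇒strictlySurjective {suc n} h h-injective c with any? (λ t → h t ≟ c)
... | yes hit = hit
... | no miss = contradiction (injective⇒≤ h′-injective) (n≮n n)
  where
  c≢h : ∀ t → c ≢ h t
  c≢h t c≡ht = miss (t , sym c≡ht)
  h′ : Fin (suc n) → Fin n
  h′ t = punchOut (c≢h t)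
  h′-injective : Injective _≡_ _≡_ h′
  h′-injective = h-injective ∘ punchOut-injective (c≢h _) (c≢h _)

∑-𝟙-injective : (h : Fin n → Fin n) → Injective _≡_ _≡_ h → ∀ c → ∑[ t < n ] 𝟙 (h t ≟ c) ≡ 1
∑-𝟙-injective h h-injective c =
  let t₀ , ht₀≡c = injective⇒strictlySurjective h h-injective c in
  ∑-𝟙-unique (λ t → h t ≟ c) t₀ ht₀≡c (λ t ht≡c → h-injective (trans ht≡c (sym ht₀≡c)))

T-is-just⇒ : {x : Maybe A} → T (is-just x) → ∃ λ a → x ≡ just a
T-is-just⇒ {x = just a} _ = a , refl

cyclePred : Fin (suc n) → Fin (suc n)
cyclePred {n} zero = fromℕ n
cyclePred (suc i) = inject₁ i

cyclePred-injective : Injective _≡_ _≡_ (cyclePred {n})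
cyclePred-injective {x = zero}  {zero}  _  = refl
cyclePred-injective {x = zero}  {suc j} eq = contradiction eq fromℕ≢inject₁
cyclePred-injective {x = suc i} {zero}  eq = contradiction (sym eq) fromℕ≢inject₁
cyclePred-injective {x = suc i} {suc j} eq = cong suc (inject₁-injective eq)

cycleSucc : Fin (suc n) → Fin (suc n)
cycleSucc i = proj₁ (injective⇒strictlySurjective cyclePred cyclePred-injective i)

cyclePred-cycleSucc : ∀ (i : Fin (suc n)) → cyclePred (cycleSucc i) ≡ i
cyclePred-cycleSucc i = proj₂ (injective⇒strictlySurjective cyclePred cyclePred-injective i)

cycleSucc-cyclePred : ∀ (i : Fin (suc n)) → cycleSucc (cyclePred i) ≡ i
cycleSucc-cyclePred i = cyclePred-injective (cyclePred-cycleSucc (cyclePred i))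

cyclePred-invariant⇒constant : (h : Fin (suc n) → A) → (∀ i → h (cyclePred i) ≡ h i) →
  ∀ i → h i ≡ h zero
cyclePred-invariant⇒constant h invariant =
  <-weakInduction (λ i → h i ≡ h zero) refl (λ j hj≡h0 → trans (sym (invariant (suc j))) hj≡h0)

corner-forced : (h : Fin (suc n) → Fin (suc n) → ℕ) (y : ℕ) →
  (∀ j → ∑[ k < suc n ] h j k ≡ 1) →
  (∀ k → ∑[ j < suc n ] h j (suc k) ≡ 1) →
  y + ∑[ j < n ] h (suc j) zero ≡ 1 →
  h zero zero ≡ y
corner-forced {n} h y rows columns column₀ =
  +-cancelʳ-≡ R (h zero zero) y (trans corner+R≡1 (sym column₀))
  where
  open ≡-Reasoning
  R : ℕ
  R = ∑[ j < n ] h (suc j) zero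
  corner+R≡1 : h zero zero + R ≡ 1
  corner+R≡1 = +-cancelʳ-≡ n _ _ (begin
    h zero zero + R + n
      ≡⟨ cong (h zero zero + R +_) (trans (sum-cong-≗ columns) (∑-ones n)) ⟨
    h zero zero + R + ∑[ k < n ] ∑[ j < suc n ] h j (suc k)
      ≡⟨ ∑-comm h ⟨
    ∑[ j < suc n ] ∑[ k < suc n ] h j k
      ≡⟨ trans (sum-cong-≗ rows) (∑-ones (suc n)) ⟩
    suc n ∎)

record Star (G : Graph) (v : Fin (Graph.n G)) (k : ℕ) : Set where
  field
    edgeAt           : Fin k → Fin (Graph.m G)
    edgeAt-injective : Injective _≡_ _≡_ edgeAt
    edgeAt-incident  : ∀ t → Incident G v (edgeAt t)
    edgeAt-complete  : ∀ e → Incident G v e → ∃ λ t → edgeAt t ≡ e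

open Star

degree-star : ∀ {G v k} → Star G v k → degree G v ≡ k
degree-star {G} {v} s =
  length-filter-allFin (incident? G v) (edgeAt s)
    (edgeAt-injective s) (edgeAt-incident s) (edgeAt-complete s)

proper⇒∑-𝟙-star : ∀ {d G v f} → ProperEdgeColoring d G f → (s : Star G v d) →
  ∀ c → ∑[ t < d ] 𝟙 (f (edgeAt s t) ≟ c) ≡ 1
proper⇒∑-𝟙-star {v = v} {f} proper s = ∑-𝟙-injective (f ∘ edgeAt s) colour-injective
  where
  colour-injective : Injective _≡_ _≡_ (f ∘ edgeAt s)
  colour-injective {t} {t′} same with t ≟ t′
  ... | yes t≡t′ = t≡t′
  ... | no t≢t′ = contradiction same
    (proper _ _ (t≢t′ ∘ edgeAt-injective s , v , edgeAt-incident s t , edgeAt-incident s t′))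

module Construction (n : ℕ) where

  d : ℕ
  d = suc n

  left : Fin d → Fin d → Fin (d * d + d * d)
  left i j = combine i j ↑ˡ (d * d)

  right : Fin d → Fin d → Fin (d * d + d * d)
  right i k = (d * d) ↑ʳ combine i k

  side : Fin (d * d + d * d) → Bool
  side = [ const true , const false ]′ ∘ splitAt (d * d)

  side-left : ∀ i j → side (left i j) ≡ true
  side-left i j = cong [ const true , const false ]′ (splitAt-↑ˡ (d * d) (combine i j) (d * d))

  side-right : ∀ i k → side (right i k) ≡ false
  side-right i k = cong [ const true , const false ]′ (splitAt-↑ʳ (d * d) (d * d) (combine i k))

  left≢right : ∀ i j i′ k → left i j ≢ right i′ k
  left≢right i j i′ k eq with trans (sym (side-left i j)) (trans (cong side eq) (side-right i′ k))
  ... | ()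

  left-injective : ∀ i j i′ j′ → left i j ≡ left i′ j′ → i ≡ i′ × j ≡ j′
  left-injective i j i′ j′ = combine-injective i j i′ j′ ∘ ↑ˡ-injective (d * d) _ _

  right-injective : ∀ i k i′ k′ → right i k ≡ right i′ k′ → i ≡ i′ × k ≡ k′
  right-injective i k i′ k′ = combine-injective i k i′ k′ ∘ ↑ʳ-injective (d * d) _ _

  vertex-view : ∀ v → (∃₂ λ i j → left i j ≡ v) ⊎ (∃₂ λ i k → right i k ≡ v)
  vertex-view v with splitAt (d * d) v | join-splitAt (d * d) (d * d) v
  ... | inj₁ x | eq with i , j , refl ← combine-surjective {d} {d} x = inj₁ (i , j , eq)
  ... | inj₂ y | eq with i , k , refl ← combine-surjective {d} {d} y = inj₂ (i , k , eq)

  edge : Fin d → Fin d → Fin d → Fin (d * (d * d))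
  edge i j k = combine i (combine j k)

  decode : Fin (d * (d * d)) → Fin d × Fin d × Fin d
  decode = map₂ (remQuot d) ∘ remQuot (d * d)

  decode-edge : ∀ i j k → decode (edge i j k) ≡ (i , j , k)
  decode-edge i j k = trans (cong (map₂ (remQuot d)) (remQuot-combine {d} {d * d} i (combine j k)))
                            (cong (i ,_) (remQuot-combine {d} {d} j k))

  edge-injective : ∀ i j k i′ j′ k′ → edge i j k ≡ edge i′ j′ k′ → i ≡ i′ × j ≡ j′ × k ≡ k′
  edge-injective i j k i′ j′ k′ eq =
    let i≡i′ , jk≡jk′ = combine-injective i (combine j k) i′ (combine j′ k′) eq in
    i≡i′ , combine-injective j k j′ k′ jk≡jk′

  edge-surjective : ∀ e → ∃ λ i → ∃₂ λ j k → edge i j k ≡ e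
  edge-surjective e with combine-surjective {d} {d * d} e
  ... | i , jk , refl with combine-surjective {d} {d} jk
  ...   | j , k , refl = i , j , k , refl

  target : Fin d → Fin d → Fin d → Fin d
  target i zero    zero    = cycleSucc i
  target i zero    (suc _) = i
  target i (suc _) _       = i

  endpoints : Fin d × Fin d × Fin d → Fin (d * d + d * d) × Fin (d * d + d * d)
  endpoints (i , j , k) = left i j , right (target i j k) k

  G : Graph
  G = record { n = d * d + d * d ; m = d * (d * d) ; ends = endpoints ∘ decode }

  src-edge : ∀ i j k → src G (edge i j k) ≡ left i j
  src-edge i j k = cong (proj₁ ∘ endpoints) (decode-edge i j k)

  tgt-edge : ∀ i j k → tgt G (edge i j k) ≡ right (target i j k) k
  tgt-edge i j k = cong (proj₂ ∘ endpoints) (decode-edge i j k)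

  incident-left : ∀ i′ j′ i j k → Incident G (left i′ j′) (edge i j k) → i ≡ i′ × j ≡ j′
  incident-left i′ j′ i j k (inj₁ src≡) =
    left-injective i j i′ j′ (trans (sym (src-edge i j k)) src≡)
  incident-left i′ j′ i j k (inj₂ tgt≡) =
    contradiction (trans (sym tgt≡) (tgt-edge i j k)) (left≢right i′ j′ (target i j k) k)

  incident-right : ∀ i′ k′ i j k → Incident G (right i′ k′) (edge i j k) →
    target i j k ≡ i′ × k ≡ k′
  incident-right i′ k′ i j k (inj₁ src≡) =
    contradiction (trans (sym (src-edge i j k)) src≡) (left≢right i j i′ k′)
  incident-right i′ k′ i j k (inj₂ tgt≡) =
    right-injective (target i j k) k i′ k′ (trans (sym (tgt-edge i j k)) tgt≡)

  simple : Simple G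
  simple = no-loop , no-parallel
    where
    no-loop : ∀ e → src G e ≢ tgt G e
    no-loop e with i , j , k , refl ← edge-surjective e = λ eq →
      left≢right i j (target i j k) k (trans (sym (src-edge i j k)) (trans eq (tgt-edge i j k)))
    no-parallel : ∀ e e′ → e ≢ e′ → ¬ ((src G e ≡ src G e′ × tgt G e ≡ tgt G e′)
                                      ⊎ (src G e ≡ tgt G e′ × tgt G e ≡ src G e′))
    no-parallel e e′ e≢e′ with edge-surjective e | edge-surjective e′
    ... | i , j , k , refl | i′ , j′ , k′ , refl = λ where
      (inj₁ (src≡ , tgt≡)) →
        let i≡i′ , j≡j′ = incident-left i′ j′ i j k (inj₁ (trans src≡ (src-edge i′ j′ k′)))
            _ , k≡k′ =
              incident-right (target i′ j′ k′) k′ i j k (inj₂ (trans tgt≡ (tgt-edge i′ j′ k′)))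
        in e≢e′ (trans (cong₂ (λ i″ j″ → edge i″ j″ k) i≡i′ j≡j′) (cong (edge i′ j′) k≡k′))
      (inj₂ (src≡ , _)) →
        left≢right i j (target i′ j′ k′) k′
          (trans (sym (src-edge i j k)) (trans src≡ (tgt-edge i′ j′ k′)))

  side-src : ∀ e → side (src G e) ≡ true
  side-src e with i , j , k , refl ← edge-surjective e =
    trans (cong side (src-edge i j k)) (side-left i j)

  side-tgt : ∀ e → side (tgt G e) ≡ false
  side-tgt e with i , j , k , refl ← edge-surjective e =
    trans (cong side (tgt-edge i j k)) (side-right (target i j k) k)

  bipartite : Bipartite G
  bipartite = side , side-differs
    where
    side-differs : ∀ e → side (src G e) ≢ side (tgt G e)
    side-differs e same with trans (sym (side-src e)) (trans same (side-tgt e))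
    ... | ()

  leftStar : ∀ i j → Star G (left i j) d
  leftStar i j = record
    { edgeAt           = edge i j
    ; edgeAt-injective = λ {k} {k′} → proj₂ ∘ proj₂ ∘ edge-injective i j k i j k′
    ; edgeAt-incident  = λ k → inj₁ (src-edge i j k)
    ; edgeAt-complete  = complete
    }
    where
    complete : ∀ e → Incident G (left i j) e → ∃ λ k → edge i j k ≡ e
    complete e at with i′ , j′ , k , refl ← edge-surjective e with incident-left i j i′ j′ k at
    ... | refl , refl = k , refl

  column : Fin d → Fin d → Fin d → Fin (d * (d * d))
  column i zero    zero    = edge (cyclePred i) zero zero
  column i zero    (suc j) = edge i (suc j) zero
  column i (suc k) j       = edge i j (suc k)

  row : Fin (d * (d * d)) → Fin d
  row = proj₁ ∘ proj₂ ∘ decode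

  row-column : ∀ i k t → row (column i k t) ≡ t
  row-column i zero    zero    = cong (proj₁ ∘ proj₂) (decode-edge (cyclePred i) zero zero)
  row-column i zero    (suc j) = cong (proj₁ ∘ proj₂) (decode-edge i (suc j) zero)
  row-column i (suc k) j       = cong (proj₁ ∘ proj₂) (decode-edge i j (suc k))

  column-incident : ∀ i k t → Incident G (right i k) (column i k t)
  column-incident i zero    zero    =
    inj₂ (trans (tgt-edge (cyclePred i) zero zero)
                (cong (λ x → right x zero) (cycleSucc-cyclePred i)))
  column-incident i zero    (suc j) = inj₂ (tgt-edge i (suc j) zero)
  column-incident i (suc k) zero    = inj₂ (tgt-edge i zero (suc k))
  column-incident i (suc k) (suc j) = inj₂ (tgt-edge i (suc j) (suc k))

  column-complete : ∀ i k i′ j′ k′ → target i′ j′ k′ ≡ i → k′ ≡ k →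
    ∃ λ t → column i k t ≡ edge i′ j′ k′
  column-complete _ _ i′ zero    zero    refl refl =
    zero , cong (λ x → edge x zero zero) (cyclePred-cycleSucc i′)
  column-complete _ _ _  zero    (suc _) refl refl = zero , refl
  column-complete _ _ _  (suc j) zero    refl refl = suc j , refl
  column-complete _ _ _  (suc j) (suc _) refl refl = suc j , refl

  rightStar : ∀ i k → Star G (right i k) d
  rightStar i k = record
    { edgeAt           = column i k
    ; edgeAt-injective = λ {t} {t′} eq →
        trans (sym (row-column i k t)) (trans (cong row eq) (row-column i k t′))
    ; edgeAt-incident  = column-incident i k
    ; edgeAt-complete  = complete
    }
    where
    complete : ∀ e → Incident G (right i k) e → ∃ λ t → column i k t ≡ e
    complete e at with i′ , j′ , k′ , refl ← edge-surjective e =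
      let target≡i , k′≡k = incident-right i k i′ j′ k′ at in
      column-complete i k i′ j′ k′ target≡i k′≡k

  regular : Regular d G
  regular v with vertex-view v
  ... | inj₁ (i , j , refl) = degree-star (leftStar i j)
  ... | inj₂ (i , k , refl) = degree-star (rightStar i k)

  link : Fin d → Fin (d * (d * d))
  link i = edge i zero zero

  precolour : Fin d × Fin d × Fin d → Maybe (Fin d)
  precolour (i , zero  , zero ) = just i
  precolour (_ , zero  , suc _) = nothing
  precolour (_ , suc _ , _    ) = nothing

  φ : PartialColoring d G
  φ = precolour ∘ decode

  φ-link : ∀ i → φ (link i) ≡ just i
  φ-link i = cong precolour (decode-edge i zero zero)

  φ≡just⇒link : ∀ e c → φ e ≡ just c → e ≡ link c
  φ≡just⇒link e c φe≡c with i , j , k , refl ← edge-surjective e =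
    precolour≡just⇒link i j k (trans (sym (cong precolour (decode-edge i j k))) φe≡c)
    where
    precolour≡just⇒link : ∀ i j k → precolour (i , j , k) ≡ just c → edge i j k ≡ link c
    precolour≡just⇒link _ zero zero refl = refl

  proper : ProperPartial d G φ
  proper e e′ c c′ (e≢e′ , _) φe≡c φe′≡c′ c≡c′ =
    e≢e′ (trans (φ≡just⇒link e c φe≡c) (trans (cong link c≡c′) (sym (φ≡just⇒link e′ c′ φe′≡c′))))

  numColored≡d : numColored {d} {G} φ ≡ d
  numColored≡d = length-filter-allFin (λ e → T? (is-just (φ e))) link
    (λ {c} {c′} → proj₁ ∘ edge-injective c zero zero c′ zero zero)
    (λ c → subst (T ∘ is-just) (sym (φ-link c)) tt)
    (λ e coloured → let c , φe≡c = T-is-just⇒ coloured in c , sym (φ≡just⇒link e c φe≡c))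

  link-colour-invariant : ∀ {f} → ProperEdgeColoring d G f →
    ∀ i → f (link (cyclePred i)) ≡ f (link i)
  link-colour-invariant {f} proper i =
    𝟙≡1⇒ (f (link (cyclePred i)) ≟ c) (trans (sym corner) (𝟙-yes (c ≟ c) refl))
    where
    c : Fin d
    c = f (link i)
    corner : 𝟙 (f (link i) ≟ c) ≡ 𝟙 (f (link (cyclePred i)) ≟ c)
    corner = corner-forced (λ j k → 𝟙 (f (edge i j k) ≟ c)) _
      (λ j → proper⇒∑-𝟙-star proper (leftStar i j) c)
      (λ k → proper⇒∑-𝟙-star proper (rightStar i (suc k)) c)
      (proper⇒∑-𝟙-star proper (rightStar i zero) c)

  not-avoidable : ¬ Avoidable d G φ
  not-avoidable (f , proper , avoids) =
    avoids (link c₀) (trans (φ-link c₀) (cong just (sym (constant c₀))))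
    where
    c₀ : Fin d
    c₀ = f (link zero)
    constant : ∀ i → f (link i) ≡ c₀
    constant = cyclePred-invariant⇒constant (f ∘ link) (link-colour-invariant proper)

proposition3p2 : (d : ℕ) → d ≥ 1 →
    Σ Graph λ G → Simple G × Bipartite G × Regular d G ×
      Σ (PartialColoring d G) λ φ →
        ProperPartial d G φ × numColored {d} {G} φ ≡ d × ¬ Avoidable d G φ
proposition3p2 (suc n) _ =
  G , simple , bipartite , regular , φ , proper , numColored≡d , not-avoidable
  where open Construction n
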